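{- Let $d$ be odd and let $B,B_1,\dots,B_N$ be arbitrary bubbles (planar or not). Then no $G\in\mathcal{G}^{\max}_{n_1,\dots,n_N}(\vec B;B_1,\dots,B_N)$ has a 4-bond made of edges of color 0.
   Context: A $(d+1)$-colored graph is a connected bipartite multigraph with edge colors in $\{0,\dots,d\}$, each vertex incident to exactly one edge of each color; a bubble is a connected bipartite multigraph with edge colors in $\{1,\dots,d\}$ with each vertex incident to exactly one edge of each color. $\vec B$ denotes $B$ with labeled vertices. $\mathcal{G}_{n_1,\dots,n_N}(\vec B;B_1,\dots,B_N)$ is the set of $(d+1)$-colored graphs which, after deleting color-0 edges, consist of one marked copy of $\vec B$ and $n_i$ copies of $B_i$; $C_0(G)$ is the total number of cycles alternating colors $0$ and $c$, over $c=1,\dots,d$; $\mathcal{G}^{\max}_{n_1,\dots,n_N}(\vec B;B_1,\dots,B_N)$ is the subset maximizing $C_0$. A $k$-bond is a set of $k$ edges whose removal disconnects the graph and no proper subset of which does. -}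

module Defs where

open import Data.Nat using (ℕ; zero; suc; _+_; _*_)
open import Data.Bool using (Bool)
open import Data.Fin using (Fin; zero; suc)
open import Data.Fin.Subset using (Subset; _∈_; _∉_)
open import Data.Product using (Σ; ∃; ∃-syntax; _×_; _,_; proj₁; proj₂)
open import Data.Sum using (_⊎_; inj₁; inj₂)
open import Relation.Nullary using (¬_)
open import Relation.Binary.PropositionalEquality using (_≡_; _≢_)
open import Relation.Binary.Construct.Closure.ReflexiveTransitive using (Star)
open import Function.Bundles using (_↔_; Inverse)

Odd : ℕ → Set
Odd d = ∃[ k ] d ≡ suc (2 * k)

sumFin : ∀ {k} → (Fin k → ℕ) → ℕ
sumFin {zero}  f = 0
sumFin {suc k} f = f zero + sumFin (λ i → f (suc i))

-- Edge-coloured multigraphs in which every vertex is incident to exactly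
-- one edge of each colour.  The edges of colour c are the unordered pairs
-- {v , ι c v}; an edge is represented by (c , v) for either endpoint v.

record ColGraph (V : Set) (K : Set) : Set where
  field
    ι     : K → V → V
    invol : ∀ c v → ι c (ι c v) ≡ v
    noLoop : ∀ c v → ι c v ≢ v
open ColGraph public

Bipartite : ∀ {V K} → ColGraph V K → Set
Bipartite {V} {K} g = Σ (V → Bool) λ f → (c : K) (v : V) → f (ι g c v) ≢ f v

AdjCol : ∀ {V K} → ColGraph V K → (K → Set) → V → V → Set
AdjCol {V} {K} g S v w = Σ K λ c → S c × w ≡ ι g c v

AdjDel : ∀ {V K} → ColGraph V K → (K → V → Set) → V → V → Set
AdjDel {V} {K} g Del v w = Σ K λ c → ¬ Del c v × w ≡ ι g c v

Adj : ∀ {V K} → ColGraph V K → V → V → Set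
Adj {V} {K} g v w = Σ K λ c → w ≡ ι g c v

ConnectedRel : ∀ {V : Set} → (V → V → Set) → Set
ConnectedRel {V} R = (v w : V) → Star R v w

Connected : ∀ {V K} → ColGraph V K → Set
Connected g = ConnectedRel (Adj g)

NumComponents : ∀ {n} → (Fin n → Fin n → Set) → ℕ → Set
NumComponents {n} R C =
  Σ (Fin n → Fin C) λ lab →
    ((j : Fin C) → ∃[ v ] lab v ≡ j) ×
    ((v w : Fin n) → (lab v ≡ lab w → Star R v w) × (Star R v w → lab v ≡ lab w))

-- Bubbles: connected bipartite graphs with colours 1..d
-- (colour 1+c is represented by c : Fin d).

record Bubble (d : ℕ) : Set where
  field
    size  : ℕ
    graph : ColGraph (Fin size) (Fin d)
    bip   : Bipartite graph
    conn  : Connected graph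
open Bubble public

-- (d+1)-coloured graphs: connected bipartite graphs with colours 0..d
-- (colour 0 is zero, colour 1+c is suc c).

record CGraph (d : ℕ) : Set where
  field
    nV    : ℕ
    gr    : ColGraph (Fin nV) (Fin (suc d))
    bipG  : Bipartite gr
    connG : Connected gr
open CGraph public

UnionV : ∀ {d N} → Bubble d → (Fin N → Bubble d) → (Fin N → ℕ) → Set
UnionV {d} {N} B Bs ns = Fin (size B) ⊎ Σ (Fin N) (λ i → Fin (ns i) × Fin (size (Bs i)))

unionι : ∀ {d N} (B : Bubble d) (Bs : Fin N → Bubble d) (ns : Fin N → ℕ) →
         Fin d → UnionV B Bs ns → UnionV B Bs ns
unionι B Bs ns c (inj₁ v) = inj₁ (ι (graph B) c v)
unionι B Bs ns c (inj₂ (i , j , v)) = inj₂ (i , j , ι (graph (Bs i)) c v)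

-- G ∈ 𝒢_{n_1..n_N}(B; B_1..B_N): deleting the colour-0 edges of G leaves a
-- graph isomorphic (colour-preservingly) to B ⊔ n_1 B_1 ⊔ ... ⊔ n_N B_N.
InSet : ∀ {d N} → Bubble d → (Fin N → Bubble d) → (Fin N → ℕ) → CGraph d → Set
InSet {d} B Bs ns G =
  Σ (Fin (nV G) ↔ UnionV B Bs ns) λ φ →
    (c : Fin d) (v : Fin (nV G)) →
      Inverse.to φ (ι (gr G) (suc c) v) ≡ unionι B Bs ns c (Inverse.to φ v)

Col0or : ∀ {d} → Fin (suc d) → Fin (suc d) → Set
Col0or c c' = (c' ≡ zero) ⊎ (c' ≡ c)

-- C₀(G) = k : the total number of bicoloured cycles of colours {0, c},
-- c = 1..d, i.e. connected components of the {0,c}-subgraph, summed over c.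
C0 : ∀ {d} → CGraph d → ℕ → Set
C0 {d} G k =
  Σ (Fin d → ℕ) λ ks →
    ((c : Fin d) → NumComponents (AdjCol (gr G) (Col0or (suc c))) (ks c)) ×
    k ≡ sumFin ks

InMaxSet : ∀ {d N} → Bubble d → (Fin N → Bubble d) → (Fin N → ℕ) → CGraph d → Set
InMaxSet B Bs ns G =
  InSet B Bs ns G ×
  ∃[ k ] (C0 G k × (∀ G' k' → InSet B Bs ns G' → C0 G' k' → k' Data.Nat.≤ k))
  where import Data.Nat

Edge : ∀ {d} → CGraph d → Set
Edge {d} G = Fin (suc d) × Fin (nV G)

SameEdge : ∀ {d} (G : CGraph d) → Fin (suc d) → Fin (nV G) → Edge G → Set
SameEdge G c w (c' , v) = c ≡ c' × (w ≡ v ⊎ w ≡ ι (gr G) c' v)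

DelSet : ∀ {d k} (G : CGraph d) → (Fin k → Edge G) → Subset k →
         Fin (suc d) → Fin (nV G) → Set
DelSet G es T c w = ∃[ i ] (i ∈ T × SameEdge G c w (es i))

IsBond : ∀ {d k} (G : CGraph d) → (Fin k → Edge G) → Set
IsBond {d} {k} G es =
  ((i j : Fin k) → SameEdge G (proj₁ (es i)) (proj₂ (es i)) (es j) → i ≡ j) ×
  ¬ ConnectedRel (AdjDel (gr G) (DelSet G es Data.Fin.Subset.⊤)) ×
  ((T : Subset k) → ∃[ i ] i ∉ T → ConnectedRel (AdjDel (gr G) (DelSet G es T)))
  where import Data.Fin.Subset

-- Write the four colour-0 bond edges as {black i, white i}.  Deleting all of them leaves two
-- sides, and by minimality of the bond every bond edge joins them.  Rematching black 0 and black J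
-- to each other's white partner changes colour 0 only, so the result lies in the same set 𝒢, and it
-- stays connected because it contains G minus three of the bond edges.
-- Fix a colour c.  In the {0,c}-graph minus the bond edges each endpoint ends a path, which joins
-- black i to white (π i), and π alternates between the sides.  The {0,c}-cycles through the bond
-- then correspond to the cycles of π⁻¹ ∘ ρ, where ρ is the rematching, so a swap changes the
-- number of {0,c}-cycles by exactly one, and for two swaps J₁, J₂ chosen from the sides alone the
-- two changes add up to at least 0.  Maximality of C₀(G) then forces the first swap to keep C₀,
-- i.e. d changes of ±1 add up to 0, which is impossible for odd d.

module Submission where

open import Defs
open import Data.Bool.Base using (Bool; true; false; not; if_then_else_)
import Data.Bool.Properties as Bool
open import Data.Bool.Properties using (¬-not; not-involutive)
open import Data.Empty using (⊥; ⊥-elim)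
open import Data.Fin.Base using (Fin; zero; suc; toℕ; punchOut; punchIn)
open import Data.Fin.Permutation
  using (Permutation′; _⟨$⟩ʳ_; _⟨$⟩ˡ_; inverseˡ; inverseʳ; transpose; id)
import Data.Fin.Permutation.Components as PC
open import Data.Fin.Properties
  using (_≟_; all?; any?; injective⇒≤; punchOut-injective; punchOut-cong; punchOut-punchIn; punchInᵢ≢i;
         pigeonhole)
open import Data.Fin.Subset using (⊤; ⁅_⁆; ∁)
open import Data.Fin.Subset.Properties using (∈⊤; x∈⁅x⁆; x∈⁅y⁆⇒x≡y; x∈p⇒x∉∁p; x∉p⇒x∈∁p)
open import Data.List.Base using (List; []; _∷_; map; _++_; allFin)
open import Data.List.Properties using (map-id)
open import Data.List.Membership.Propositional using (_∈_)
open import Data.List.Membership.Propositional.Properties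
  using (∈-map⁺; ∈-map⁻; ∈-++⁺ˡ; ∈-++⁺ʳ; ∈-++⁻; ∈-allFin)
open import Data.List.Relation.Unary.Any using (here; there)
open import Data.Nat.Base using (ℕ; zero; suc; _+_; _*_; _≤_; _<_; z≤n; s≤s; parity)
import Data.Nat.Properties as ℕ
open import Algebra.Properties.CommutativeSemigroup ℕ.+-commutativeSemigroup using (interchange)
open import Data.Nat.Properties
  using (_≤?_; ≤-refl; ≤-trans; ≤-antisym; ≤-reflexive; n≤1+n; m≤n⇒m<n∨m≡n; m≤n⇒∃[o]m+o≡n;
         +-suc; +-identityʳ; +-mono-≤; +-monoˡ-≤; +-monoʳ-≤; +-cancelˡ-≤; +-cancelʳ-≤)
open import Data.Parity.Base using (0ℙ; 1ℙ; _⁻¹)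
import Data.Parity.Base as ℙ
open import Data.Parity.Properties using (+-homo-+; *-homo-*; suc-homo-⁻¹; ⁻¹-selfInverse; p+p≡0ℙ)
open import Data.Product.Base using (Σ; ∃; ∃-syntax; ∃₂; _×_; _,_; proj₁; proj₂)
import Data.Product.Base as Product
open import Data.Sum.Base using (_⊎_; inj₁; inj₂)
open import Data.Vec.Base using (Vec; []; _∷_; lookup; tabulate)
open import Data.Vec.Properties using (lookup∘tabulate)
open import Function.Base using (_∘_)
open import Function.Definitions using (Injective)
open import Level using (0ℓ; lift)
open import Relation.Binary.Core using (Rel; _⇒_)
open import Relation.Binary.Construct.Closure.ReflexiveTransitive using (Star; ε; _◅_; _◅◅_; _⋆)
import Relation.Binary.Construct.Closure.ReflexiveTransitive as Star
open import Relation.Binary.Construct.Never using (Never)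
open import Relation.Binary.Definitions using (DecidableEquality)
open import Relation.Binary.PropositionalEquality
  using (_≡_; _≢_; refl; sym; trans; cong; cong₂; subst; subst₂; _≗_; module ≡-Reasoning)
open import Relation.Nullary using (¬_; Dec; yes; no)
open import Relation.Nullary.Decidable using (_×-dec_; _⊎-dec_; _→-dec_; ¬?; toWitness; map′; dec-false)
open import Relation.Unary using (Pred; Decidable)

module _ {n : ℕ} where

  addEdge : Rel (Fin n) 0ℓ → Fin n → Fin n → Rel (Fin n) 0ℓ
  addEdge R u v x y = R x y ⊎ (x ≡ u × y ≡ v) ⊎ (x ≡ v × y ≡ u)

  addEdges : Rel (Fin n) 0ℓ → List (Fin n × Fin n) → Rel (Fin n) 0ℓ
  addEdges R [] = R
  addEdges R ((u , v) ∷ es) = addEdges (addEdge R u v) es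

  addEdges⁺ : ∀ {R} es {x y} → R x y ⊎ (x , y) ∈ es ⊎ (y , x) ∈ es → addEdges R es x y
  addEdges⁺ [] (inj₁ r) = r
  addEdges⁺ [] (inj₂ (inj₁ ()))
  addEdges⁺ [] (inj₂ (inj₂ ()))
  addEdges⁺ (_ ∷ es) (inj₁ r) = addEdges⁺ es (inj₁ (inj₁ r))
  addEdges⁺ (_ ∷ es) (inj₂ (inj₁ (here refl))) = addEdges⁺ es (inj₁ (inj₂ (inj₁ (refl , refl))))
  addEdges⁺ (_ ∷ es) (inj₂ (inj₁ (there xy∈es))) = addEdges⁺ es (inj₂ (inj₁ xy∈es))
  addEdges⁺ (_ ∷ es) (inj₂ (inj₂ (here refl))) = addEdges⁺ es (inj₁ (inj₂ (inj₂ (refl , refl))))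
  addEdges⁺ (_ ∷ es) (inj₂ (inj₂ (there yx∈es))) = addEdges⁺ es (inj₂ (inj₂ yx∈es))

  addEdges⁻ : ∀ {R} es {x y} → addEdges R es x y → R x y ⊎ (x , y) ∈ es ⊎ (y , x) ∈ es
  addEdges⁻ [] r = inj₁ r
  addEdges⁻ (_ ∷ es) r with addEdges⁻ es r
  ... | inj₁ (inj₁ r′) = inj₁ r′
  ... | inj₁ (inj₂ (inj₁ (refl , refl))) = inj₂ (inj₁ (here refl))
  ... | inj₁ (inj₂ (inj₂ (refl , refl))) = inj₂ (inj₂ (here refl))
  ... | inj₂ (inj₁ xy∈es) = inj₂ (inj₁ (there xy∈es))
  ... | inj₂ (inj₂ yx∈es) = inj₂ (inj₂ (there yx∈es))

  ViaEdge : Rel (Fin n) 0ℓ → Fin n → Fin n → Rel (Fin n) 0ℓ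
  ViaEdge R u v x y = Star R x y ⊎ (Star R x u × Star R v y) ⊎ (Star R x v × Star R u y)

  star-addEdge⁻ : ∀ {R u v x y} → Star (addEdge R u v) x y → ViaEdge R u v x y
  star-addEdge⁻ ε = inj₁ ε
  star-addEdge⁻ (inj₁ r ◅ rs) with star-addEdge⁻ rs
  ... | inj₁ p = inj₁ (r ◅ p)
  ... | inj₂ (inj₁ (p , q)) = inj₂ (inj₁ (r ◅ p , q))
  ... | inj₂ (inj₂ (p , q)) = inj₂ (inj₂ (r ◅ p , q))
  star-addEdge⁻ (inj₂ (inj₁ (refl , refl)) ◅ rs) with star-addEdge⁻ rs
  ... | inj₁ p = inj₂ (inj₁ (ε , p))
  ... | inj₂ (inj₁ (_ , q)) = inj₂ (inj₁ (ε , q))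
  ... | inj₂ (inj₂ (_ , q)) = inj₁ q
  star-addEdge⁻ (inj₂ (inj₂ (refl , refl)) ◅ rs) with star-addEdge⁻ rs
  ... | inj₁ p = inj₂ (inj₂ (ε , p))
  ... | inj₂ (inj₁ (_ , q)) = inj₁ q
  ... | inj₂ (inj₂ (_ , q)) = inj₂ (inj₂ (ε , q))

  star-addEdge⁺ : ∀ {R u v x y} → ViaEdge R u v x y → Star (addEdge R u v) x y
  star-addEdge⁺ (inj₁ p) = Star.map inj₁ p
  star-addEdge⁺ (inj₂ (inj₁ (p , q))) =
    star-addEdge⁺ (inj₁ p) ◅◅ inj₂ (inj₁ (refl , refl)) ◅ star-addEdge⁺ (inj₁ q)
  star-addEdge⁺ (inj₂ (inj₂ (p , q))) =
    star-addEdge⁺ (inj₁ p) ◅◅ inj₂ (inj₂ (refl , refl)) ◅ star-addEdge⁺ (inj₁ q)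

JoinedVia : {P Q : Set} → (P → Q) → P → P → P → P → Set
JoinedVia lab a b x y =
  lab x ≡ lab y ⊎ (lab x ≡ lab a × lab b ≡ lab y) ⊎ (lab x ≡ lab b × lab a ≡ lab y)

module _ {P Q : Set} {n : ℕ} where

  Labels : Rel (Fin n) 0ℓ → (P → Fin n) → (P → Q) → Set
  Labels R pt lab =
    ∀ a b → (lab a ≡ lab b → Star R (pt a) (pt b)) × (Star R (pt a) (pt b) → lab a ≡ lab b)

  labels-viaEdge⁻ : ∀ {R pt lab a b x y} → Labels R pt lab →
                    ViaEdge R (pt a) (pt b) (pt x) (pt y) → JoinedVia lab a b x y
  labels-viaEdge⁻ {x = x} {y} labels (inj₁ p) = inj₁ (proj₂ (labels x y) p)
  labels-viaEdge⁻ {a = a} {b} {x} {y} labels (inj₂ (inj₁ (p , q))) =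
    inj₂ (inj₁ (proj₂ (labels x a) p , proj₂ (labels b y) q))
  labels-viaEdge⁻ {a = a} {b} {x} {y} labels (inj₂ (inj₂ (p , q))) =
    inj₂ (inj₂ (proj₂ (labels x b) p , proj₂ (labels a y) q))

  labels-viaEdge⁺ : ∀ {R pt lab a b x y} → Labels R pt lab →
                    JoinedVia lab a b x y → ViaEdge R (pt a) (pt b) (pt x) (pt y)
  labels-viaEdge⁺ {x = x} {y} labels (inj₁ e) = inj₁ (proj₁ (labels x y) e)
  labels-viaEdge⁺ {a = a} {b} {x} {y} labels (inj₂ (inj₁ (e , e′))) =
    inj₂ (inj₁ (proj₁ (labels x a) e , proj₁ (labels b y) e′))
  labels-viaEdge⁺ {a = a} {b} {x} {y} labels (inj₂ (inj₂ (e , e′))) =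
    inj₂ (inj₂ (proj₁ (labels x b) e , proj₁ (labels a y) e′))

  labels-addEdge-joined : ∀ {R pt lab a b} → Labels R pt lab → lab a ≡ lab b →
                          Labels (addEdge R (pt a) (pt b)) pt lab
  labels-addEdge-joined {lab = lab} {a} {b} labels lab-a≡lab-b x y =
    (λ e → star-addEdge⁺ (inj₁ (proj₁ (labels x y) e))) ,
    (λ p → joined (labels-viaEdge⁻ labels (star-addEdge⁻ p)))
    where
    joined : JoinedVia lab a b x y → lab x ≡ lab y
    joined (inj₁ e) = e
    joined (inj₂ (inj₁ (e , e′))) = trans e (trans lab-a≡lab-b e′)
    joined (inj₂ (inj₂ (e , e′))) = trans e (trans (sym lab-a≡lab-b) e′)

module UnionFind {P Q : Set} (_≟Q_ : DecidableEquality Q) where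

  union : (P → Q) → P → P → P → Q
  union lab a b x with lab x ≟Q lab b
  ... | yes _ = lab a
  ... | no _ = lab x

  union-≢ : ∀ lab a b {x} → lab x ≢ lab b → union lab a b x ≡ lab x
  union-≢ lab a b {x} x≁b with lab x ≟Q lab b
  ... | yes x~b = ⊥-elim (x≁b x~b)
  ... | no _ = refl

  merges : (P → Q) → List (P × P) → ℕ
  merges lab [] = 0
  merges lab ((a , b) ∷ es) with lab a ≟Q lab b
  ... | yes _ = merges lab es
  ... | no _ = suc (merges (union lab a b) es)

  union-cong : ∀ {lab lab′} → lab ≗ lab′ → ∀ a b → union lab a b ≗ union lab′ a b
  union-cong {lab} {lab′} lab≗lab′ a b x with lab x ≟Q lab b | lab′ x ≟Q lab′ b
  ... | yes _ | yes _ = lab≗lab′ a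
  ... | yes e | no ne = ⊥-elim (ne (trans (sym (lab≗lab′ x)) (trans e (lab≗lab′ b))))
  ... | no ne | yes e = ⊥-elim (ne (trans (lab≗lab′ x) (trans e (sym (lab≗lab′ b)))))
  ... | no _ | no _ = lab≗lab′ x

  merges-cong : ∀ {lab lab′} → lab ≗ lab′ → ∀ es → merges lab es ≡ merges lab′ es
  merges-cong lab≗lab′ [] = refl
  merges-cong {lab} {lab′} lab≗lab′ ((a , b) ∷ es) with lab a ≟Q lab b | lab′ a ≟Q lab′ b
  ... | yes _ | yes _ = merges-cong lab≗lab′ es
  ... | yes e | no ne = ⊥-elim (ne (trans (sym (lab≗lab′ a)) (trans e (lab≗lab′ b))))
  ... | no ne | yes e = ⊥-elim (ne (trans (lab≗lab′ a) (trans e (sym (lab≗lab′ b)))))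
  ... | no _ | no _ = cong suc (merges-cong (union-cong lab≗lab′ a b) es)

  union-joined⁻ : ∀ lab a b x y → union lab a b x ≡ union lab a b y → JoinedVia lab a b x y
  union-joined⁻ lab a b x y e with lab x ≟Q lab b | lab y ≟Q lab b
  ... | yes x~b | yes y~b = inj₁ (trans x~b (sym y~b))
  ... | yes x~b | no _ = inj₂ (inj₂ (x~b , e))
  ... | no _ | yes y~b = inj₂ (inj₁ (e , sym y~b))
  ... | no _ | no _ = inj₁ e

  union-joined⁺ : ∀ lab a b x y → JoinedVia lab a b x y → union lab a b x ≡ union lab a b y
  union-joined⁺ lab a b x y j with lab x ≟Q lab b | lab y ≟Q lab b | j
  ... | yes _ | yes _ | _ = refl
  ... | yes x~b | no y≁b | inj₁ e = ⊥-elim (y≁b (trans (sym e) x~b))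
  ... | yes _ | no y≁b | inj₂ (inj₁ (_ , e)) = ⊥-elim (y≁b (sym e))
  ... | yes _ | no _ | inj₂ (inj₂ (_ , e)) = e
  ... | no x≁b | yes y~b | inj₁ e = ⊥-elim (x≁b (trans e y~b))
  ... | no _ | yes _ | inj₂ (inj₁ (e , _)) = e
  ... | no x≁b | yes _ | inj₂ (inj₂ (e , _)) = ⊥-elim (x≁b e)
  ... | no _ | no _ | inj₁ e = e
  ... | no _ | no y≁b | inj₂ (inj₁ (_ , e)) = ⊥-elim (y≁b (sym e))
  ... | no x≁b | no _ | inj₂ (inj₂ (e , _)) = ⊥-elim (x≁b e)

  labels-addEdge-union : ∀ {n} {R : Rel (Fin n) 0ℓ} {pt lab} a b → Labels R pt lab →
                         Labels (addEdge R (pt a) (pt b)) pt (union lab a b)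
  labels-addEdge-union {lab = lab} a b labels x y =
    (λ e → star-addEdge⁺ (labels-viaEdge⁺ labels (union-joined⁻ lab a b x y e))) ,
    (λ p → union-joined⁺ lab a b x y (labels-viaEdge⁻ labels (star-addEdge⁻ p)))

open UnionFind using (union; union-≢; labels-addEdge-union)

module _ {n : ℕ} where

  numComponents-cong : ∀ {R S : Rel (Fin n) 0ℓ} {k} → R ⇒ Star S → S ⇒ Star R →
                       NumComponents R k → NumComponents S k
  numComponents-cong R⊆S S⊆R (lab , onto , labels) =
    lab , onto , λ v w → (λ e → (R⊆S ⋆) (proj₁ (labels v w) e)) ,
                         (λ p → proj₂ (labels v w) ((S⊆R ⋆) p))

  numComponents-unique : ∀ {R : Rel (Fin n) 0ℓ} {k k′} →
                         NumComponents R k → NumComponents R k′ → k ≡ k′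
  numComponents-unique (lab , onto , labels) (lab′ , onto′ , labels′) =
    ≤-antisym (injective⇒≤ (relabel-injective onto labels labels′))
              (injective⇒≤ (relabel-injective onto′ labels′ labels))
    where
    relabel-injective : ∀ {k k′} {lab : Fin n → Fin k} {lab′ : Fin n → Fin k′} →
                        (onto : ∀ j → ∃[ v ] lab v ≡ j) →
                        Labels _ (λ v → v) lab → Labels _ (λ v → v) lab′ →
                        ∀ {i j} → lab′ (proj₁ (onto i)) ≡ lab′ (proj₁ (onto j)) → i ≡ j
    relabel-injective onto labels labels′ {i} {j} e =
      trans (sym (proj₂ (onto i)))
            (trans (proj₂ (labels _ _) (proj₁ (labels′ _ _) e)) (proj₂ (onto j)))

  numComponents-never : NumComponents {n} Never n
  numComponents-never =
    (λ v → v) , (λ j → j , refl) , λ v w → (λ { refl → ε }) , λ { ε → refl ; (lift () ◅ _) }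

  numComponents-addEdge-joined : ∀ {R : Rel (Fin n) 0ℓ} {k u v} → NumComponents R k → Star R u v →
                                 NumComponents (addEdge R u v) k
  numComponents-addEdge-joined {u = u} {v} (lab , onto , labels) u~v =
    lab , onto , labels-addEdge-joined {a = u} {b = v} labels (proj₂ (labels u v) u~v)

  numComponents-punchOut : ∀ {R : Rel (Fin n) 0ℓ} {k} (lab : Fin n → Fin (suc k)) (p : Fin (suc k)) →
                           (avoids : ∀ x → p ≢ lab x) → (∀ j → j ≢ p → ∃[ x ] lab x ≡ j) →
                           Labels R (λ x → x) lab → NumComponents R k
  numComponents-punchOut lab p avoids onto labels = (λ x → punchOut (avoids x)) , onto′ , labels′
    where
    onto′ : ∀ j → ∃[ x ] punchOut (avoids x) ≡ j
    onto′ j with onto (punchIn p j) (punchInᵢ≢i p j)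
    ... | x , lab-x = x , trans (punchOut-cong p lab-x) (punchOut-punchIn p)
    labels′ : Labels _ (λ x → x) (λ x → punchOut (avoids x))
    labels′ v w = (λ e → proj₁ (labels v w) (punchOut-injective (avoids v) (avoids w) e)) ,
                  (λ q → punchOut-cong p (proj₂ (labels v w) q))

  numComponents-addEdge-separate : ∀ {R : Rel (Fin n) 0ℓ} {k u v} → NumComponents R k → ¬ Star R u v →
                                   ∃[ k′ ] k ≡ suc k′ × NumComponents (addEdge R u v) k′
  numComponents-addEdge-separate {k = zero} {u = u} (lab , _) _ with lab u
  ... | ()
  numComponents-addEdge-separate {k = suc k} {u} {v} (lab , onto , labels) u≁v =
    k , refl , numComponents-punchOut merged (lab v) avoids onto′ (labels-addEdge-union _≟_ u v labels)
    where
    merged : Fin n → Fin (suc k)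
    merged = union _≟_ lab u v
    lab-u≢lab-v : lab u ≢ lab v
    lab-u≢lab-v e = u≁v (proj₁ (labels u v) e)
    avoids : ∀ x → lab v ≢ merged x
    avoids x with lab x ≟ lab v
    ... | yes _ = λ e → lab-u≢lab-v (sym e)
    ... | no x≁v = λ e → x≁v (sym e)
    onto′ : ∀ j → j ≢ lab v → ∃[ x ] merged x ≡ j
    onto′ j j≢lab-v with onto j
    ... | x , refl = x , union-≢ _≟_ lab u v j≢lab-v

module _ {P Q : Set} (_≟Q_ : DecidableEquality Q) {n : ℕ} (pt : P → Fin n) where

  open UnionFind {P} _≟Q_ using (merges)

  numComponents-addEdges : ∀ {R κ lab} → NumComponents R κ → Labels R pt lab → ∀ es →
    ∃[ κ′ ] NumComponents (addEdges R (map (Product.map pt pt) es)) κ′ × κ′ + merges lab es ≡ κ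
  numComponents-addEdges {κ = κ} count labels [] = κ , count , +-identityʳ κ
  numComponents-addEdges {lab = lab} count labels ((a , b) ∷ es) with lab a ≟Q lab b
  ... | yes a~b =
    numComponents-addEdges (numComponents-addEdge-joined count (proj₁ (labels a b) a~b))
                           (labels-addEdge-joined {a = a} {b} labels a~b) es
  ... | no a≁b with numComponents-addEdge-separate count (λ p → a≁b (proj₂ (labels a b) p))
  ...   | κ₁ , refl , count₁ =
    let κ′ , count′ , κ′+m≡κ₁ = numComponents-addEdges count₁ (labels-addEdge-union _≟Q_ a b labels) es
    in κ′ , count′ , trans (+-suc κ′ _) (cong suc κ′+m≡κ₁)

numComponents-exists : ∀ {n} (es : List (Fin n × Fin n)) → ∃[ κ ] NumComponents (addEdges Never es) κ
numComponents-exists es =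
  let κ , count , _ =
        numComponents-addEdges _≟_ (λ v → v) numComponents-never (proj₂ (proj₂ numComponents-never)) es
  in κ , subst (λ es′ → NumComponents (addEdges Never es′) κ) (map-id es) count

module _ {n : ℕ} (f g : Fin n → Fin n)
         (f-involutive : ∀ v → f (f v) ≡ v) (g-involutive : ∀ v → g (g v) ≡ v) where

  private
    edges : List (Fin n × Fin n)
    edges = map (λ v → v , f v) (allFin n) ++ map (λ v → v , g v) (allFin n)

    step⁺ : ∀ {x y} → (y ≡ f x ⊎ y ≡ g x) → addEdges Never edges x y
    step⁺ {x} (inj₁ refl) =
      addEdges⁺ edges (inj₂ (inj₁ (∈-++⁺ˡ (∈-map⁺ (λ v → v , f v) (∈-allFin x)))))
    step⁺ {x} (inj₂ refl) =
      addEdges⁺ edges (inj₂ (inj₁ (∈-++⁺ʳ _ (∈-map⁺ (λ v → v , g v) (∈-allFin x)))))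

    edge⁻ : ∀ {x y} → (x , y) ∈ edges → y ≡ f x ⊎ y ≡ g x
    edge⁻ xy∈ with ∈-++⁻ (map (λ v → v , f v) (allFin n)) xy∈
    ... | inj₁ xy∈f with ∈-map⁻ (λ v → v , f v) xy∈f
    ...   | _ , _ , refl = inj₁ refl
    edge⁻ xy∈ | inj₂ xy∈g with ∈-map⁻ (λ v → v , g v) xy∈g
    ...   | _ , _ , refl = inj₂ refl

    step⁻ : ∀ {x y} → addEdges Never edges x y → (y ≡ f x ⊎ y ≡ g x)
    step⁻ r with addEdges⁻ edges r
    ... | inj₁ (lift ())
    ... | inj₂ (inj₁ xy∈) = edge⁻ xy∈
    ... | inj₂ (inj₂ yx∈) with edge⁻ yx∈
    ...   | inj₁ refl = inj₁ (sym (f-involutive _))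
    ...   | inj₂ refl = inj₂ (sym (g-involutive _))

  numComponents-involutions : ∃[ κ ] NumComponents (λ x y → y ≡ f x ⊎ y ≡ g x) κ
  numComponents-involutions =
    let κ , count = numComponents-exists edges
    in κ , numComponents-cong (λ r → step⁻ r ◅ ε) (λ r → step⁺ r ◅ ε) count

leastWitness : ∀ {P : Pred ℕ 0ℓ} → Decidable P → ∀ {k} → P k →
               ∃[ m ] P m × (∀ j → j < m → ¬ P j)
leastWitness P? {zero} p = zero , p , λ _ ()
leastWitness P? {suc k} p with P? zero
... | yes p₀ = zero , p₀ , λ _ ()
... | no ¬p₀ with leastWitness (λ j → P? (suc j)) p
...   | m , pm , below = suc m , pm , λ { zero _ → ¬p₀ ; (suc j) (s≤s j<m) → below j j<m }

module TwoMatchings {n : ℕ} (α β : Fin n → Fin n)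
  (α-involutive : ∀ v → α (α v) ≡ v) (β-involutive : ∀ v → β (β v) ≡ v)
  (colour : Fin n → Bool)
  (α-flips : ∀ v → colour (α v) ≢ colour v) (β-flips : ∀ v → colour (β v) ≢ colour v)
  (X : Pred (Fin n) 0ℓ) (X? : Decidable X) (α-closed : ∀ v → X v → X (α v)) where

  αX : Fin n → Fin n
  αX v with X? v
  ... | yes _ = v
  ... | no _ = α v

  αX-inside : ∀ {v} → X v → αX v ≡ v
  αX-inside {v} v∈X with X? v
  ... | yes _ = refl
  ... | no v∉X = ⊥-elim (v∉X v∈X)

  αX-outside : ∀ {v} → ¬ X v → αX v ≡ α v
  αX-outside {v} v∉X with X? v
  ... | yes v∈X = ⊥-elim (v∉X v∈X)
  ... | no _ = refl

  α-closed⁻ : ∀ v → X (α v) → X v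
  α-closed⁻ v αv∈X = subst X (α-involutive v) (α-closed (α v) αv∈X)

  αX-involutive : ∀ v → αX (αX v) ≡ v
  αX-involutive v with X? v
  ... | yes v∈X = αX-inside v∈X
  ... | no v∉X = trans (αX-outside (λ αv∈X → v∉X (α-closed⁻ v αv∈X))) (α-involutive v)

  CutUnion : Rel (Fin n) 0ℓ
  CutUnion x y = y ≡ β x ⊎ y ≡ αX x

  cutUnion-sym : ∀ {x y} → CutUnion x y → CutUnion y x
  cutUnion-sym {x} (inj₁ refl) = inj₁ (sym (β-involutive x))
  cutUnion-sym {x} (inj₂ refl) = inj₂ (sym (αX-involutive x))

  τ : Fin n → Fin n
  τ v = α (β v)

  τ-injective : ∀ {u w} → τ u ≡ τ w → u ≡ w
  τ-injective {u} {w} e = begin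
    u               ≡⟨ sym (β-involutive u) ⟩
    β (β u)         ≡⟨ cong β (sym (α-involutive (β u))) ⟩
    β (α (τ u))     ≡⟨ cong (λ t → β (α t)) e ⟩
    β (α (τ w))     ≡⟨ cong β (α-involutive (β w)) ⟩
    β (β w)         ≡⟨ β-involutive w ⟩
    w               ∎
    where open ≡-Reasoning

  τ-colour : ∀ v → colour (τ v) ≡ colour v
  τ-colour v =
    trans (¬-not (α-flips (β v))) (trans (cong not (¬-not (β-flips v))) (not-involutive (colour v)))

  walk : Fin n → ℕ → Fin n
  walk x zero = x
  walk x (suc k) = τ (walk x k)

  walk-+ : ∀ x a b → walk x (a + b) ≡ walk (walk x b) a
  walk-+ x zero b = refl
  walk-+ x (suc a) b = cong τ (walk-+ x a b)

  walk-injective : ∀ a {u w} → walk u a ≡ walk w a → u ≡ w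
  walk-injective zero e = e
  walk-injective (suc a) e = walk-injective a (τ-injective e)

  walk-colour : ∀ x k → colour (walk x k) ≡ colour x
  walk-colour x zero = refl
  walk-colour x (suc k) = trans (τ-colour (walk x k)) (walk-colour x k)

  walk-returns : ∀ x → ∃[ o ] walk x (suc o) ≡ x
  walk-returns x with pigeonhole ≤-refl (λ (i : Fin (suc n)) → walk x (toℕ i))
  ... | i , j , i<j , same with m≤n⇒∃[o]m+o≡n i<j
  ...   | o , i+1+o≡j = o , walk-injective (toℕ i) (sym (begin
    walk x (toℕ i)                   ≡⟨ same ⟩
    walk x (toℕ j)                   ≡⟨ cong (walk x) (sym i+1+o≡j) ⟩
    walk x (suc (toℕ i) + o)         ≡⟨ cong (walk x) (sym (+-suc (toℕ i) o)) ⟩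
    walk x (toℕ i + suc o)           ≡⟨ walk-+ x (toℕ i) (suc o) ⟩
    walk (walk x (suc o)) (toℕ i)    ∎))
    where open ≡-Reasoning

  record Partner (x : Fin n) : Set where
    field
      end : Fin n
      end∈X : X end
      end-colour : colour end ≢ colour x
      path : Star CutUnion x end
      only : ∀ z → X z → Star CutUnion x z → z ≡ x ⊎ z ≡ end

  -- The path from x alternates β- and α-edges, visiting walk x k and β (walk x k),
  -- until the first k at which β (walk x k) lies in X.
  module _ (x : Fin n) (x∈X : X x) where

    Exits : ℕ → Set
    Exits k = X (β (walk x k))

    exits-eventually : ∃ Exits
    exits-eventually with walk-returns x
    ... | o , returns = o , subst X (sym β-walk≡αx) (α-closed x x∈X)
      where
      β-walk≡αx : β (walk x o) ≡ α x
      β-walk≡αx = trans (sym (α-involutive (β (walk x o)))) (cong α returns)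

    firstExit : ∃[ k ] Exits k × (∀ j → j < k → ¬ Exits j)
    firstExit = leastWitness {P = Exits} (λ k → X? (β (walk x k)))
                             {proj₁ exits-eventually} (proj₂ exits-eventually)

    K : ℕ
    K = proj₁ firstExit

    exits-at-K : Exits K
    exits-at-K = proj₁ (proj₂ firstExit)

    stays-before-K : ∀ j → j < K → ¬ Exits j
    stays-before-K = proj₂ (proj₂ firstExit)

    OnSegment : Fin n → Set
    OnSegment z = ∃[ k ] k ≤ K × (z ≡ walk x k ⊎ z ≡ β (walk x k))

    onSegment-step : ∀ {v w} → OnSegment v → CutUnion v w → OnSegment w
    onSegment-step (k , k≤K , inj₁ refl) (inj₁ refl) = k , k≤K , inj₂ refl
    onSegment-step (k , k≤K , inj₂ refl) (inj₁ refl) = k , k≤K , inj₁ (β-involutive (walk x k))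
    onSegment-step (k , k≤K , inj₁ refl) (inj₂ refl) with X? (walk x k)
    ... | yes _ = k , k≤K , inj₁ refl
    onSegment-step (zero , k≤K , inj₁ refl) (inj₂ refl) | no x∉X = ⊥-elim (x∉X x∈X)
    onSegment-step (suc k , k<K , inj₁ refl) (inj₂ refl) | no _ =
      k , ≤-trans (n≤1+n k) k<K , inj₂ (α-involutive (β (walk x k)))
    onSegment-step (k , k≤K , inj₂ refl) (inj₂ refl) with X? (β (walk x k)) | m≤n⇒m<n∨m≡n k≤K
    ... | yes _ | _ = k , k≤K , inj₂ refl
    ... | no _ | inj₁ k<K = suc k , k<K , inj₁ refl
    ... | no exits | inj₂ refl = ⊥-elim (exits exits-at-K)

    onSegment-star : ∀ {v w} → OnSegment v → Star CutUnion v w → OnSegment w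
    onSegment-star s ε = s
    onSegment-star s (r ◅ rs) = onSegment-star (onSegment-step s r) rs

    path-along : ∀ k → k ≤ K → Star CutUnion x (walk x k)
    path-along zero _ = ε
    path-along (suc k) k<K =
      path-along k (≤-trans (n≤1+n k) k<K) ◅◅
      inj₁ refl ◅ inj₂ (sym (αX-outside (stays-before-K k k<K))) ◅ ε

    -- opaque: unfolding the search for K at use sites makes type checking very slow.
    opaque
      partner : Partner x
      partner = record
        { end = β (walk x K)
        ; end∈X = exits-at-K
        ; end-colour = λ e → β-flips (walk x K) (trans e (sym (walk-colour x K)))
        ; path = path-along K ≤-refl ◅◅ inj₁ refl ◅ ε
        ; only = only
        }
        where
        only : ∀ z → X z → Star CutUnion x z → z ≡ x ⊎ z ≡ β (walk x K)
        only z z∈X p with onSegment-star (zero , z≤n , inj₁ refl) p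
        ... | zero , _ , inj₁ refl = inj₁ refl
        ... | suc k , k<K , inj₁ refl = ⊥-elim (stays-before-K k k<K (α-closed⁻ _ z∈X))
        ... | k , k≤K , inj₂ refl with m≤n⇒m<n∨m≡n k≤K
        ...   | inj₁ k<K = ⊥-elim (stays-before-K k k<K z∈X)
        ...   | inj₂ refl = inj₂ refl

sumFin-+ : ∀ {k} (f g : Fin k → ℕ) → sumFin (λ c → f c + g c) ≡ sumFin f + sumFin g
sumFin-+ {zero} f g = refl
sumFin-+ {suc k} f g = begin
  (f zero + g zero) + sumFin (λ c → f (suc c) + g (suc c))
    ≡⟨ cong (f zero + g zero +_) (sumFin-+ (f ∘ suc) (g ∘ suc)) ⟩
  (f zero + g zero) + (sumFin (f ∘ suc) + sumFin (g ∘ suc))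
    ≡⟨ interchange (f zero) (g zero) _ _ ⟩
  (f zero + sumFin (f ∘ suc)) + (g zero + sumFin (g ∘ suc))
    ∎
  where open ≡-Reasoning

sumFin-cong : ∀ {k} {f g : Fin k → ℕ} → (∀ c → f c ≡ g c) → sumFin f ≡ sumFin g
sumFin-cong {zero} f≗g = refl
sumFin-cong {suc k} f≗g = cong₂ _+_ (f≗g zero) (sumFin-cong (f≗g ∘ suc))

sumFin-mono-≤ : ∀ {k} {f g : Fin k → ℕ} → (∀ c → f c ≤ g c) → sumFin f ≤ sumFin g
sumFin-mono-≤ {zero} f≤g = z≤n
sumFin-mono-≤ {suc k} f≤g = +-mono-≤ (f≤g zero) (sumFin-mono-≤ (f≤g ∘ suc))

sumFin-balance : ∀ {d} {k m k′ m′ : Fin d → ℕ} → (∀ c → k c + m c ≡ k′ c + m′ c) →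
                 sumFin k + sumFin m ≡ sumFin k′ + sumFin m′
sumFin-balance {k = k} {m} {k′} {m′} balance =
  trans (sym (sumFin-+ k m)) (trans (sumFin-cong balance) (sumFin-+ k′ m′))

parity-suc : ∀ n → parity (suc n) ≡ parity n ⁻¹
parity-suc n = sym (⁻¹-selfInverse (suc-homo-⁻¹ n))

parity-double : ∀ n → parity (n + n) ≡ 0ℙ
parity-double n = trans (+-homo-+ n n) (p+p≡0ℙ (parity n))

parity-sumFin : ∀ {k} (f : Fin k → ℕ) → (∀ c → parity (f c) ≡ 1ℙ) →
                parity (sumFin f) ≡ parity k
parity-sumFin {zero} f odd = refl
parity-sumFin {suc k} f odd = begin
  parity (f zero + sumFin (f ∘ suc))
    ≡⟨ +-homo-+ (f zero) _ ⟩
  parity (f zero) ℙ.+ parity (sumFin (f ∘ suc))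
    ≡⟨ cong₂ ℙ._+_ (odd zero) (parity-sumFin _ (odd ∘ suc)) ⟩
  1ℙ ℙ.+ parity k
    ≡⟨ parity-suc k ⟨
  parity (suc k)
    ∎
  where open ≡-Reasoning

OneApart : ℕ → ℕ → Set
OneApart a b = a ≡ suc b ⊎ b ≡ suc a

parity-oneApart : ∀ {a b} → OneApart a b → parity (a + b) ≡ 1ℙ
parity-oneApart {b = b} (inj₁ refl) = trans (parity-suc (b + b)) (cong _⁻¹ (parity-double b))
parity-oneApart {a} (inj₂ refl) =
  trans (cong parity (+-suc a a)) (trans (parity-suc (a + a)) (cong _⁻¹ (parity-double a)))

parity-odd : ∀ {d} → Odd d → parity d ≡ 1ℙ
parity-odd (k , refl) = trans (parity-suc (2 * k)) (cong _⁻¹ (*-homo-* 2 k))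

sumFin-oneApart : ∀ {d} → Odd d → (a b : Fin d → ℕ) → (∀ c → OneApart (a c) (b c)) →
                  sumFin a ≢ sumFin b
sumFin-oneApart {d} odd a b apart Σa≡Σb = 0ℙ≢1ℙ (begin
  0ℙ                                       ≡⟨ p+p≡0ℙ (parity (sumFin a)) ⟨
  parity (sumFin a) ℙ.+ parity (sumFin a)  ≡⟨ +-homo-+ (sumFin a) (sumFin a) ⟨
  parity (sumFin a + sumFin a)             ≡⟨ cong (λ s → parity (sumFin a + s)) Σa≡Σb ⟩
  parity (sumFin a + sumFin b)             ≡⟨ cong parity (sumFin-+ a b) ⟨
  parity (sumFin (λ c → a c + b c))        ≡⟨ parity-sumFin _ (λ c → parity-oneApart (apart c)) ⟩
  parity d                                 ≡⟨ parity-odd odd ⟩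
  1ℙ                                       ∎)
  where open ≡-Reasoning
        0ℙ≢1ℙ : 0ℙ ≢ 1ℙ
        0ℙ≢1ℙ ()

swap-balance : ∀ {k k₁ k₂ m m₁ m₂} → k + m ≡ k₁ + m₁ → k + m ≡ k₂ + m₂ →
               k₁ ≤ k → k₂ ≤ k → m₁ + m₂ ≤ m + m → m₁ ≡ m
swap-balance {k} {m = m} {m₁} {m₂} balance₁ balance₂ k₁≤k k₂≤k m₁+m₂≤m+m =
  ≤-antisym m₁≤m (m≤ balance₁ k₁≤k)
  where
  m≤ : ∀ {k′ m′} → k + m ≡ k′ + m′ → k′ ≤ k → m ≤ m′
  m≤ {m′ = m′} balance k′≤k =
    +-cancelˡ-≤ k m m′ (≤-trans (≤-reflexive balance) (+-monoˡ-≤ m′ k′≤k))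
  m₁≤m : m₁ ≤ m
  m₁≤m = +-cancelʳ-≤ m₂ m₁ m (≤-trans m₁+m₂≤m+m (+-monoʳ-≤ m (m≤ balance₂ k₂≤k)))

SwapInequalities : ℕ → ℕ → ℕ → Set
SwapInequalities m m₁ m₂ = OneApart m₁ m × m₁ + m₂ ≤ m + m

record SwapComponents (k k₁ k₂ : ℕ) : Set where
  field
    m m₁ m₂ : ℕ
    balance₁ : k + m ≡ k₁ + m₁
    balance₂ : k + m ≡ k₂ + m₂
    inequalities : SwapInequalities m m₁ m₂

no-balanced-swaps : ∀ {d} → Odd d → {k k₁ k₂ : Fin d → ℕ} →
                    (∀ c → SwapComponents (k c) (k₁ c) (k₂ c)) →
                    sumFin k₁ ≤ sumFin k → sumFin k₂ ≤ sumFin k → ⊥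
no-balanced-swaps odd swaps Σk₁≤Σk Σk₂≤Σk =
  sumFin-oneApart odd m₁ m (λ c → proj₁ (inequalities (swaps c)))
    (swap-balance (sumFin-balance (λ c → balance₁ (swaps c)))
                  (sumFin-balance (λ c → balance₂ (swaps c)))
                  Σk₁≤Σk Σk₂≤Σk
       (begin
         sumFin m₁ + sumFin m₂        ≡⟨ sumFin-+ m₁ m₂ ⟨
         sumFin (λ c → m₁ c + m₂ c)   ≤⟨ sumFin-mono-≤ (λ c → proj₂ (inequalities (swaps c))) ⟩
         sumFin (λ c → m c + m c)     ≡⟨ sumFin-+ m m ⟩
         sumFin m + sumFin m          ∎))
  where
  open SwapComponents using (balance₁; balance₂; inequalities)
  open ℕ.≤-Reasoning
  m m₁ m₂ : Fin _ → ℕ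
  m c = SwapComponents.m (swaps c)
  m₁ c = SwapComponents.m₁ (swaps c)
  m₂ c = SwapComponents.m₂ (swaps c)

-- (k , true) and (k , false) stand for the black and the white endpoint of the k-th bond edge.
Point : Set
Point = Fin 4 × Bool

blackPt whitePt : Fin 4 → Point
blackPt k = k , true
whitePt k = k , false

rewiredMatching : Permutation′ 4 → List (Point × Point)
rewiredMatching ρ = map (λ k → blackPt k , whitePt (ρ ⟨$⟩ʳ k)) (allFin 4)

-- Before the matching is added, black i lies in the component of white (π i).
componentOf : (Fin 4 → Fin 4) → Point → Fin 4
componentOf π (i , true) = π i
componentOf π (j , false) = j

open UnionFind {Point} (_≟_ {4}) using (merges; merges-cong)

mergesAfter : (Fin 4 → Fin 4) → Permutation′ 4 → ℕ
mergesAfter π ρ = merges (componentOf π) (rewiredMatching ρ)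

SwapCounts : (Fin 4 → Fin 4) → Fin 4 → Fin 4 → Set
SwapCounts π J₁ J₂ =
  SwapInequalities (mergesAfter π id) (mergesAfter π (transpose zero J₁))
                   (mergesAfter π (transpose zero J₂))

Alternating : (Fin 4 → Bool) → (Fin 4 → Fin 4) → Set
Alternating side π = ∀ i → side i ≢ side (π i)

private

  all-Bool? : {Q : Pred Bool 0ℓ} → Decidable Q → Dec (∀ b → Q b)
  all-Bool? Q? =
    map′ (λ { (t , f) true → t ; (t , f) false → f }) (λ h → h true , h false) (Q? true ×-dec Q? false)

  all-Vec? : {A : Set} → (∀ {Q : Pred A 0ℓ} → Decidable Q → Dec (∀ a → Q a)) →
             ∀ {k} {P : Pred (Vec A k) 0ℓ} → Decidable P → Dec (∀ v → P v)
  all-Vec? all-A? {ℕ.zero} P? = map′ (λ { p [] → p }) (λ h → h []) (P? [])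
  all-Vec? all-A? {suc k} P? =
    map′ (λ { h (a ∷ v) → h a v }) (λ h a v → h (a ∷ v))
         (all-A? (λ a → all-Vec? all-A? (λ v → P? (a ∷ v))))

  swapCounts? : ∀ π J₁ J₂ → Dec (SwapCounts π J₁ J₂)
  swapCounts? π J₁ J₂ = ((m₁ ℕ.≟ suc m) ⊎-dec (m ℕ.≟ suc m₁)) ×-dec (m₁ + m₂ ≤? m + m)
    where
    m = mergesAfter π id
    m₁ = mergesAfter π (transpose zero J₁)
    m₂ = mergesAfter π (transpose zero J₂)

  SwapsFor : Vec Bool 4 → Set
  SwapsFor side = ∃₂ λ J₁ J₂ → ∀ (π : Vec (Fin 4) 4) → (∀ i j → lookup π i ≡ lookup π j → i ≡ j) →
    Alternating (lookup side) (lookup π) → SwapCounts (lookup π) J₁ J₂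

  swapsFor? : ∀ side → Dec (SwapsFor side)
  swapsFor? side = any? λ J₁ → any? λ J₂ → all-Vec? all? λ π →
    all? (λ i → all? λ j → (lookup π i ≟ lookup π j) →-dec (i ≟ j)) →-dec
    (all? (λ i → ¬? (lookup side i Bool.≟ lookup side (lookup π i))) →-dec swapCounts? (lookup π) J₁ J₂)

  swapsForAll : ∀ side → SwapsFor side
  swapsForAll = toWitness {a? = all-Vec? all-Bool? swapsFor?} _

  lookup-tabulate-injective : ∀ {π : Fin 4 → Fin 4} → Injective _≡_ _≡_ π →
                              ∀ i j → lookup (tabulate π) i ≡ lookup (tabulate π) j → i ≡ j
  lookup-tabulate-injective {π} π-injective i j e =
    π-injective (trans (sym (lookup∘tabulate π i)) (trans e (lookup∘tabulate π j)))

  lookup-tabulate-alternating : ∀ {side π} → Alternating side π →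
                                Alternating (lookup (tabulate side)) (lookup (tabulate π))
  lookup-tabulate-alternating {side} {π} alternating i e =
    alternating i (trans (sym (lookup∘tabulate side i))
                         (trans e (trans (lookup∘tabulate side (lookup (tabulate π) i))
                                         (cong side (lookup∘tabulate π i)))))

  swapInequalities-cong : ∀ {m m′ m₁ m₁′ m₂ m₂′} → m ≡ m′ → m₁ ≡ m₁′ → m₂ ≡ m₂′ →
                          SwapInequalities m m₁ m₂ → SwapInequalities m′ m₁′ m₂′
  swapInequalities-cong refl refl refl s = s

  lookup-tabulate-swapCounts : ∀ {π J₁ J₂} → SwapCounts (lookup (tabulate π)) J₁ J₂ →
                               SwapCounts π J₁ J₂
  lookup-tabulate-swapCounts {π} {J₁} {J₂} =
    swapInequalities-cong (same id) (same (transpose zero J₁)) (same (transpose zero J₂))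
    where
    same : ∀ ρ → mergesAfter (lookup (tabulate π)) ρ ≡ mergesAfter π ρ
    same ρ = merges-cong {componentOf (lookup (tabulate π))} {componentOf π}
                         (λ { (i , true) → lookup∘tabulate π i ; (j , false) → refl })
                         (rewiredMatching ρ)

  fromVectors : ∀ {side} → SwapsFor (tabulate side) →
                ∃₂ λ J₁ J₂ → ∀ π → Injective _≡_ _≡_ π → Alternating side π → SwapCounts π J₁ J₂
  fromVectors {side} (J₁ , J₂ , swapsFor) = J₁ , J₂ , λ π π-injective alternating →
    lookup-tabulate-swapCounts {π}
      (swapsFor (tabulate π) (lookup-tabulate-injective {π} π-injective)
                (lookup-tabulate-alternating {side} {π} alternating))

-- Decided by evaluation; mathematically one may take for J₁, J₂ the two indices on the other side
-- from 0, since composing π⁻¹ ∘ ρ with a transposition splits or merges one cycle.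
-- opaque: unfolding the evaluation at use sites makes type checking very slow.
opaque
  swaps : ∀ (side : Fin 4 → Bool) →
          ∃₂ λ J₁ J₂ → ∀ π → Injective _≡_ _≡_ π → Alternating side π → SwapCounts π J₁ J₂
  swaps side = fromVectors (swapsForAll (tabulate side))

sameEdge-shared : ∀ {d} (G : CGraph d) {c w v v′} →
                  SameEdge G c w (c , v) → SameEdge G c w (c , v′) → SameEdge G c v (c , v′)
sameEdge-shared G (refl , inj₁ refl) (refl , w-on-v′) = refl , w-on-v′
sameEdge-shared G {c} {v = v} (refl , inj₂ refl) (refl , inj₁ refl) =
  refl , inj₂ (sym (invol (gr G) c v))
sameEdge-shared G {c} {v = v} {v′} (refl , inj₂ refl) (refl , inj₂ ιv≡ιv′) =
  refl , inj₁ (trans (sym (invol (gr G) c v)) (trans (cong (ι (gr G) c) ιv≡ιv′) (invol (gr G) c v′)))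

sameEdge-ι : ∀ {d} (G : CGraph d) {c v e} → SameEdge G c (ι (gr G) c v) e → SameEdge G c v e
sameEdge-ι G {c} {v} (refl , inj₁ ιv≡u) =
  refl , inj₂ (trans (sym (invol (gr G) c v)) (cong (ι (gr G) c) ιv≡u))
sameEdge-ι G {c} {v} {_ , u} (refl , inj₂ ιv≡ιu) =
  refl , inj₁ (trans (sym (invol (gr G) c v)) (trans (cong (ι (gr G) c) ιv≡ιu) (invol (gr G) c u)))

transpose-fixes : ∀ {m} {i j k : Fin m} → k ≢ i → k ≢ j → PC.transpose i j k ≡ k
transpose-fixes {i = i} {j} {k} k≢i k≢j
  rewrite dec-false (k ≟ i) k≢i | dec-false (k ≟ j) k≢j = refl

avoid-0-and : (J : Fin 4) → ∃[ i ] i ≢ zero × i ≢ J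
avoid-0-and zero = suc zero , (λ ()) , (λ ())
avoid-0-and (suc zero) = suc (suc zero) , (λ ()) , (λ ())
avoid-0-and (suc (suc zero)) = suc zero , (λ ()) , (λ ())
avoid-0-and (suc (suc (suc zero))) = suc zero , (λ ()) , (λ ())

module FourBond {d : ℕ} (G : CGraph d) (vs : Fin 4 → Fin (nV G))
                (bond : IsBond {d} {4} G (λ i → zero , vs i)) where

  n : ℕ
  n = nV G

  ι₀ : Fin n → Fin n
  ι₀ = ι (gr G) zero

  ι₀-involutive : ∀ v → ι₀ (ι₀ v) ≡ v
  ι₀-involutive = invol (gr G) zero

  colour : Fin n → Bool
  colour = proj₁ (bipG G)

  colour-flips : ∀ c v → colour (ι (gr G) c v) ≢ colour v
  colour-flips = proj₂ (bipG G)

  bondEdge : Fin 4 → Edge G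
  bondEdge i = zero , vs i

  OnBondEdge : Fin 4 → Fin n → Set
  OnBondEdge i v = SameEdge G zero v (bondEdge i)

  black white : Fin 4 → Fin n
  black i = if colour (vs i) then vs i else ι₀ (vs i)
  white i = ι₀ (black i)

  colour-black : ∀ i → colour (black i) ≡ true
  colour-black i with colour (vs i) in colour-vs
  ... | true = colour-vs
  ... | false = trans (¬-not (colour-flips zero (vs i))) (cong not colour-vs)

  colour-white : ∀ i → colour (white i) ≡ false
  colour-white i = trans (¬-not (colour-flips zero (black i))) (cong not (colour-black i))

  colour-white≢black : ∀ i j → colour (white i) ≢ colour (black j)
  colour-white≢black i j e with trans (sym (colour-white i)) (trans e (colour-black j))
  ... | ()

  black≢white : ∀ i j → black i ≢ white j
  black≢white i j e = colour-white≢black j i (cong colour (sym e))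

  ι₀-white : ∀ i → ι₀ (white i) ≡ black i
  ι₀-white i = ι₀-involutive (black i)

  black-onBondEdge : ∀ i → OnBondEdge i (black i)
  black-onBondEdge i with colour (vs i)
  ... | true = refl , inj₁ refl
  ... | false = refl , inj₂ refl

  white-onBondEdge : ∀ i → OnBondEdge i (white i)
  white-onBondEdge i = sameEdge-ι G (subst (OnBondEdge i) (sym (ι₀-white i)) (black-onBondEdge i))

  onBondEdge-unique : ∀ {i j v} → OnBondEdge i v → OnBondEdge j v → i ≡ j
  onBondEdge-unique {i} {j} on-i on-j = proj₁ bond i j (sameEdge-shared G on-i on-j)

  black-injective : ∀ {i j} → black i ≡ black j → i ≡ j
  black-injective {i} {j} e =
    onBondEdge-unique (black-onBondEdge i) (subst (OnBondEdge j) (sym e) (black-onBondEdge j))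

  white-injective : ∀ {i j} → white i ≡ white j → i ≡ j
  white-injective {i} {j} e =
    onBondEdge-unique (white-onBondEdge i) (subst (OnBondEdge j) (sym e) (white-onBondEdge j))

  onBondEdge⁻ : ∀ {i v} → OnBondEdge i v → v ≡ black i ⊎ v ≡ white i
  onBondEdge⁻ {i} (refl , v-on) with colour (vs i) | v-on
  ... | true | inj₁ refl = inj₁ refl
  ... | true | inj₂ refl = inj₂ refl
  ... | false | inj₁ refl = inj₂ (sym (ι₀-involutive (vs i)))
  ... | false | inj₂ refl = inj₁ refl

  onBondEdge⁺ : ∀ {i v} → v ≡ black i ⊎ v ≡ white i → OnBondEdge i v
  onBondEdge⁺ {i} (inj₁ refl) = black-onBondEdge i
  onBondEdge⁺ {i} (inj₂ refl) = white-onBondEdge i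

  Endpoint : Pred (Fin n) 0ℓ
  Endpoint v = ∃[ i ] (v ≡ black i ⊎ v ≡ white i)

  endpoint? : Decidable Endpoint
  endpoint? v = any? (λ i → (v ≟ black i) ⊎-dec (v ≟ white i))

  endpoint-ι₀ : ∀ v → Endpoint v → Endpoint (ι₀ v)
  endpoint-ι₀ v (i , inj₁ refl) = i , inj₂ refl
  endpoint-ι₀ v (i , inj₂ refl) = i , inj₁ (ι₀-white i)


  Cut : Rel (Fin n) 0ℓ
  Cut = AdjDel (gr G) (DelSet G bondEdge ⊤)

  CutExcept : Fin 4 → Rel (Fin n) 0ℓ
  CutExcept i = AdjDel (gr G) (DelSet G bondEdge (∁ ⁅ i ⁆))

  cut-colour : ∀ c {x} → Cut x (ι (gr G) (suc c) x)
  cut-colour c = suc c , (λ { (_ , _ , () , _) }) , refl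

  cut-outside : ∀ {x} → ¬ Endpoint x → Cut x (ι₀ x)
  cut-outside x∉ = zero , (λ { (i , _ , on-i) → x∉ (i , onBondEdge⁻ on-i) }) , refl

  cut-sym : ∀ {x y} → Cut x y → Cut y x
  cut-sym {x} (c , kept , refl) =
    c , (λ { (i , i∈ , on-i) → kept (i , i∈ , sameEdge-ι G on-i) }) , sym (invol (gr G) c x)

  cut-reverse : ∀ {x y} → Star Cut x y → Star Cut y x
  cut-reverse = Star.reverse cut-sym

  cutExcept-step : ∀ i {x y} → CutExcept i x y →
                   Cut x y ⊎ (y ≡ ι₀ x × (x ≡ black i ⊎ x ≡ white i))
  cutExcept-step i (suc c , _ , refl) = inj₁ (cut-colour c)
  cutExcept-step i {x} (zero , kept , refl) with endpoint? x
  ... | no x∉ = inj₁ (cut-outside x∉)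
  ... | yes (k , x-on-k) with k ≟ i
  ...   | yes refl = inj₂ (refl , x-on-k)
  ...   | no k≢i = ⊥-elim (kept (k , x∉p⇒x∈∁p (k≢i ∘ x∈⁅y⁆⇒x≡y i) , onBondEdge⁺ x-on-k))

  cutExcept-connected : ∀ i → ConnectedRel (CutExcept i)
  cutExcept-connected i = proj₂ (proj₂ bond) (∁ ⁅ i ⁆) (i , x∈p⇒x∉∁p (x∈⁅x⁆ i))

  cutExcept⊆addEdge : ∀ i → CutExcept i ⇒ Star (addEdge Cut (black i) (white i))
  cutExcept⊆addEdge i r with cutExcept-step i r
  ... | inj₁ r′ = inj₁ r′ ◅ ε
  ... | inj₂ (refl , inj₁ refl) = inj₂ (inj₁ (refl , refl)) ◅ ε
  ... | inj₂ (refl , inj₂ refl) = inj₂ (inj₂ (refl , ι₀-white i)) ◅ ε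

  joined-except : ∀ i x y → ViaEdge Cut (black i) (white i) x y
  joined-except i x y = star-addEdge⁻ ((cutExcept⊆addEdge i ⋆) (cutExcept-connected i x y))

  bondEdge-bridge : ∀ i → ¬ Star Cut (black i) (white i)
  bondEdge-bridge i b~w = proj₁ (proj₂ bond) λ x y → collapse (joined-except i x y)
    where
    collapse : ∀ {x y} → ViaEdge Cut (black i) (white i) x y → Star Cut x y
    collapse (inj₁ p) = p
    collapse (inj₂ (inj₁ (p , q))) = p ◅◅ b~w ◅◅ q
    collapse (inj₂ (inj₂ (p , q))) = p ◅◅ cut-reverse b~w ◅◅ q

  sides : ∀ x → Star Cut x (black zero) ⊎ Star Cut x (white zero)
  sides x with joined-except zero x (black zero)
  ... | inj₁ p = inj₁ p
  ... | inj₂ (inj₁ (p , _)) = inj₁ p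
  ... | inj₂ (inj₂ (p , _)) = inj₂ p

  side : Fin n → Bool
  side x with sides x
  ... | inj₁ _ = true
  ... | inj₂ _ = false

  side-cong : ∀ {x y} → Star Cut x y → side x ≡ side y
  side-cong {x} {y} p with sides x | sides y
  ... | inj₁ _ | inj₁ _ = refl
  ... | inj₂ _ | inj₂ _ = refl
  ... | inj₁ x~b | inj₂ y~w = ⊥-elim (bondEdge-bridge zero (cut-reverse x~b ◅◅ p ◅◅ y~w))
  ... | inj₂ x~w | inj₁ y~b = ⊥-elim (bondEdge-bridge zero (cut-reverse y~b ◅◅ cut-reverse p ◅◅ x~w))

  side-bondEdge : ∀ i → side (black i) ≢ side (white i)
  side-bondEdge i with sides (black i) | sides (white i)
  ... | inj₁ b~b₀ | inj₁ w~b₀ = λ _ → bondEdge-bridge i (b~b₀ ◅◅ cut-reverse w~b₀)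
  ... | inj₂ b~w₀ | inj₂ w~w₀ = λ _ → bondEdge-bridge i (b~w₀ ◅◅ cut-reverse w~w₀)
  ... | inj₁ _ | inj₂ _ = λ ()
  ... | inj₂ _ | inj₁ _ = λ ()

  record IsRewiring (ρ : Permutation′ 4) (g′ : ColGraph (Fin n) (Fin (suc d))) : Set where
    field
      other-colours : ∀ c v → ι g′ (suc c) v ≡ ι (gr G) (suc c) v
      at-black : ∀ k → ι g′ zero (black k) ≡ white (ρ ⟨$⟩ʳ k)
      at-white : ∀ k → ι g′ zero (white k) ≡ black (ρ ⟨$⟩ˡ k)
      elsewhere : ∀ {v} → ¬ Endpoint v → ι g′ zero v ≡ ι₀ v

  G-isRewiring : IsRewiring id (gr G)
  G-isRewiring = record
    { other-colours = λ _ _ → refl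
    ; at-black = λ _ → refl
    ; at-white = ι₀-white
    ; elsewhere = λ _ → refl
    }

  -- Black k is rematched to white (ρ k).  Bond edge i survives, so the result contains the
  -- connected graph G minus the other three bond edges.
  module Rewired (ρ : Permutation′ 4) {i : Fin 4} (fixed : ρ ⟨$⟩ʳ i ≡ i) where

    rewire : Fin n → Fin n
    rewire v with any? (λ k → v ≟ black k) | any? (λ k → v ≟ white k)
    ... | yes (k , _) | _ = white (ρ ⟨$⟩ʳ k)
    ... | no _ | yes (k , _) = black (ρ ⟨$⟩ˡ k)
    ... | no _ | no _ = ι₀ v

    rewire-black : ∀ k → rewire (black k) ≡ white (ρ ⟨$⟩ʳ k)
    rewire-black k with any? (λ j → black k ≟ black j) | any? (λ j → black k ≟ white j)
    ... | yes (j , e) | _ = cong (λ j′ → white (ρ ⟨$⟩ʳ j′)) (black-injective (sym e))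
    ... | no none | _ = ⊥-elim (none (k , refl))

    rewire-white : ∀ k → rewire (white k) ≡ black (ρ ⟨$⟩ˡ k)
    rewire-white k with any? (λ j → white k ≟ black j) | any? (λ j → white k ≟ white j)
    ... | yes (j , e) | _ = ⊥-elim (black≢white j k (sym e))
    ... | no _ | yes (j , e) = cong (λ j′ → black (ρ ⟨$⟩ˡ j′)) (white-injective (sym e))
    ... | no _ | no none = ⊥-elim (none (k , refl))

    rewire-outside : ∀ {v} → ¬ Endpoint v → rewire v ≡ ι₀ v
    rewire-outside {v} v∉ with any? (λ k → v ≟ black k) | any? (λ k → v ≟ white k)
    ... | yes (k , e) | _ = ⊥-elim (v∉ (k , inj₁ e))
    ... | no _ | yes (k , e) = ⊥-elim (v∉ (k , inj₂ e))
    ... | no _ | no _ = refl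

    rewire-involutive-black : ∀ k → rewire (rewire (black k)) ≡ black k
    rewire-involutive-black k =
      trans (cong rewire (rewire-black k)) (trans (rewire-white (ρ ⟨$⟩ʳ k)) (cong black (inverseˡ ρ)))

    rewire-involutive-white : ∀ k → rewire (rewire (white k)) ≡ white k
    rewire-involutive-white k =
      trans (cong rewire (rewire-white k)) (trans (rewire-black (ρ ⟨$⟩ˡ k)) (cong white (inverseʳ ρ)))

    rewire-involutive-outside : ∀ {v} → ¬ Endpoint v → rewire (rewire v) ≡ v
    rewire-involutive-outside {v} v∉ =
      trans (cong rewire (rewire-outside v∉)) (trans (rewire-outside ι₀v∉) (ι₀-involutive v))
      where
      ι₀v∉ : ¬ Endpoint (ι₀ v)
      ι₀v∉ e = v∉ (subst Endpoint (ι₀-involutive v) (endpoint-ι₀ (ι₀ v) e))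

    rewire-involutive : ∀ v → rewire (rewire v) ≡ v
    rewire-involutive v = by-cases (endpoint? v)
      where
      by-cases : Dec (Endpoint v) → rewire (rewire v) ≡ v
      by-cases (yes (k , inj₁ v≡b)) =
        subst (λ u → rewire (rewire u) ≡ u) (sym v≡b) (rewire-involutive-black k)
      by-cases (yes (k , inj₂ v≡w)) =
        subst (λ u → rewire (rewire u) ≡ u) (sym v≡w) (rewire-involutive-white k)
      by-cases (no v∉) = rewire-involutive-outside v∉

    rewire-flips : ∀ v → colour (rewire v) ≢ colour v
    rewire-flips v with endpoint? v
    ... | yes (k , inj₁ refl) =
      subst (λ u → colour u ≢ colour (black k)) (sym (rewire-black k)) (colour-white≢black _ k)
    ... | yes (k , inj₂ refl) =
      subst (λ u → colour u ≢ colour (white k)) (sym (rewire-white k)) (colour-white≢black k _ ∘ sym)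
    ... | no v∉ = subst (λ u → colour u ≢ colour v) (sym (rewire-outside v∉)) (colour-flips zero v)

    rewire-fixed : ∀ {v} → v ≡ black i ⊎ v ≡ white i → rewire v ≡ ι₀ v
    rewire-fixed (inj₁ refl) = trans (rewire-black i) (cong white fixed)
    rewire-fixed (inj₂ refl) =
      trans (rewire-white i)
            (trans (cong black (trans (cong (ρ ⟨$⟩ˡ_) (sym fixed)) (inverseˡ ρ))) (sym (ι₀-white i)))

    ιF : Fin (suc d) → Fin n → Fin n
    ιF zero = rewire
    ιF (suc c) = ι (gr G) (suc c)

    ιF-involutive : ∀ c v → ιF c (ιF c v) ≡ v
    ιF-involutive zero = rewire-involutive
    ιF-involutive (suc c) = invol (gr G) (suc c)

    ιF-flips : ∀ c v → colour (ιF c v) ≢ colour v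
    ιF-flips zero = rewire-flips
    ιF-flips (suc c) = colour-flips (suc c)

    rewiredGraph : ColGraph (Fin n) (Fin (suc d))
    rewiredGraph = record
      { ι = ιF ; invol = ιF-involutive ; noLoop = λ c v e → ιF-flips c v (cong colour e) }

    connected : Connected rewiredGraph
    connected x y = Star.map step (cutExcept-connected i x y)
      where
      step : CutExcept i ⇒ Adj rewiredGraph
      step r with cutExcept-step i r
      ... | inj₁ (suc c , _ , refl) = suc c , refl
      ... | inj₁ (zero , kept , refl) =
        zero , sym (rewire-outside (λ { (k , on-k) → kept (k , ∈⊤ , onBondEdge⁺ on-k) }))
      ... | inj₂ (refl , on-i) = zero , sym (rewire-fixed on-i)

    rewired : CGraph d
    rewired = record { nV = n ; gr = rewiredGraph ; bipG = colour , ιF-flips ; connG = connected }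

    rewired-inSet : ∀ {N} {B : Bubble d} {Bs : Fin N → Bubble d} {ns} →
                    InSet B Bs ns G → InSet B Bs ns rewired
    rewired-inSet (φ , φ-colours) = φ , φ-colours

    isRewiring : IsRewiring ρ rewiredGraph
    isRewiring = record
      { other-colours = λ _ _ → refl
      ; at-black = rewire-black
      ; at-white = rewire-white
      ; elsewhere = rewire-outside
      }

  module Colour (c : Fin d) where

    β : Fin n → Fin n
    β = ι (gr G) (suc c)

    open TwoMatchings ι₀ β ι₀-involutive (invol (gr G) (suc c))
                      colour (colour-flips zero) (colour-flips (suc c)) Endpoint endpoint? endpoint-ι₀
      using (αX; αX-inside; αX-outside; αX-involutive; CutUnion; cutUnion-sym; Partner; partner)

    cutUnion⊆cut : CutUnion ⇒ Star Cut
    cutUnion⊆cut (inj₁ refl) = cut-colour c ◅ ε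
    cutUnion⊆cut {x} (inj₂ refl) = by-cases (endpoint? x)
      where
      by-cases : Dec (Endpoint x) → Star Cut x (αX x)
      by-cases (yes x∈) = subst (Star Cut x) (sym (αX-inside x∈)) ε
      by-cases (no x∉) = subst (Cut x) (sym (αX-outside x∉)) (cut-outside x∉) ◅ ε

    cutUnion-reverse : ∀ {x y} → Star CutUnion x y → Star CutUnion y x
    cutUnion-reverse = Star.reverse cutUnion-sym

    sameColour-joined : ∀ {x z} → Endpoint x → Endpoint z → colour x ≡ colour z →
                        Star CutUnion x z → x ≡ z
    sameColour-joined {x} {z} x∈ z∈ same p with Partner.only (partner x x∈) z z∈ p
    ... | inj₁ z≡x = sym z≡x
    ... | inj₂ refl = ⊥-elim (Partner.end-colour (partner x x∈) (sym same))

    blackPartner : ∀ i → Partner (black i)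
    blackPartner i = partner (black i) (i , inj₁ refl)

    black-partner : ∀ i → ∃[ j ] Partner.end (blackPartner i) ≡ white j
    black-partner i with Partner.end∈X (blackPartner i)
    ... | j , inj₂ end≡white = j , end≡white
    ... | j , inj₁ end≡black =
      ⊥-elim (Partner.end-colour (blackPartner i)
                (trans (cong colour end≡black) (trans (colour-black j) (sym (colour-black i)))))

    π : Fin 4 → Fin 4
    π i = proj₁ (black-partner i)

    black-joined-white : ∀ i → Star CutUnion (black i) (white (π i))
    black-joined-white i =
      subst (Star CutUnion (black i)) (proj₂ (black-partner i)) (Partner.path (blackPartner i))

    joined-partner : ∀ {i j} → Star CutUnion (black i) (white j) → π i ≡ j
    joined-partner {i} {j} p with Partner.only (blackPartner i) (white j) (j , inj₂ refl) p
    ... | inj₁ w≡b = ⊥-elim (black≢white i j (sym w≡b))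
    ... | inj₂ w≡end = white-injective (trans (sym (proj₂ (black-partner i))) (sym w≡end))

    blacks-joined : ∀ {i i′} → Star CutUnion (black i) (black i′) → i ≡ i′
    blacks-joined {i} {i′} p =
      black-injective (sameColour-joined (i , inj₁ refl) (i′ , inj₁ refl)
                                         (trans (colour-black i) (sym (colour-black i′))) p)

    whites-joined : ∀ {j j′} → Star CutUnion (white j) (white j′) → j ≡ j′
    whites-joined {j} {j′} p =
      white-injective (sameColour-joined (j , inj₂ refl) (j′ , inj₂ refl)
                                         (trans (colour-white j) (sym (colour-white j′))) p)

    π-injective : Injective _≡_ _≡_ π
    π-injective {i} {i′} e =
      blacks-joined (black-joined-white i ◅◅ subst (λ j → Star CutUnion (white j) (black i′)) (sym e)
                                                    (cutUnion-reverse (black-joined-white i′)))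

    point : Point → Fin n
    point (i , true) = black i
    point (j , false) = white j

    labels : Labels CutUnion point (componentOf π)
    labels (i , true) (i′ , true) =
      (λ e → subst (λ k → Star CutUnion (black i) (black k)) (π-injective e) ε) ,
      (λ p → cong π (blacks-joined p))
    labels (i , true) (j , false) = (λ { refl → black-joined-white i }) , joined-partner
    labels (j , false) (i , true) =
      (λ { refl → cutUnion-reverse (black-joined-white i) }) ,
      (λ p → sym (joined-partner (cutUnion-reverse p)))
    labels (j , false) (j′ , false) = (λ { refl → ε }) , whites-joined

    alternating : Alternating (side ∘ black) π
    alternating i e =
      side-bondEdge (π i) (trans (sym e) (side-cong ((cutUnion⊆cut ⋆) (black-joined-white i))))

    cutUnion-components : ∃[ κ ] NumComponents CutUnion κ
    cutUnion-components = numComponents-involutions β αX (invol (gr G) (suc c)) αX-involutive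

    κ : ℕ
    κ = proj₁ cutUnion-components

    cutUnion-count : NumComponents CutUnion κ
    cutUnion-count = proj₂ cutUnion-components

    rewiredEdges : Permutation′ 4 → List (Fin n × Fin n)
    rewiredEdges ρ = map (Product.map point point) (rewiredMatching ρ)

    rewiredEdge⁺ : ∀ ρ k → (black k , white (ρ ⟨$⟩ʳ k)) ∈ rewiredEdges ρ
    rewiredEdge⁺ ρ k =
      ∈-map⁺ (Product.map point point) (∈-map⁺ (λ k → blackPt k , whitePt (ρ ⟨$⟩ʳ k)) (∈-allFin k))

    rewiredEdge⁻ : ∀ ρ {u w} → (u , w) ∈ rewiredEdges ρ →
                   ∃[ k ] u ≡ black k × w ≡ white (ρ ⟨$⟩ʳ k)
    rewiredEdge⁻ ρ uw∈ with ∈-map⁻ (Product.map point point) uw∈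
    ... | _ , pq∈ , refl with ∈-map⁻ (λ k → blackPt k , whitePt (ρ ⟨$⟩ʳ k)) pq∈
    ...   | k , _ , refl = k , refl , refl

    module _ {ρ : Permutation′ 4} {g′ : ColGraph (Fin n) (Fin (suc d))}
             (rewiring : IsRewiring ρ g′) where

      open IsRewiring rewiring

      Bicoloured : Rel (Fin n) 0ℓ
      Bicoloured = AdjCol g′ (Col0or (suc c))

      Rematched : Rel (Fin n) 0ℓ
      Rematched = addEdges CutUnion (rewiredEdges ρ)

      RematchedStep : Rel (Fin n) 0ℓ
      RematchedStep x y = CutUnion x y ⊎ (x , y) ∈ rewiredEdges ρ ⊎ (y , x) ∈ rewiredEdges ρ

      rematched⁺ : RematchedStep ⇒ Rematched
      rematched⁺ = addEdges⁺ {R = CutUnion} (rewiredEdges ρ)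

      rematched⁻ : Rematched ⇒ RematchedStep
      rematched⁻ = addEdges⁻ {R = CutUnion} (rewiredEdges ρ)

      bicoloured⊆ : Bicoloured ⇒ Star Rematched
      bicoloured⊆ {x} (suc _ , inj₂ refl , refl) = rematched⁺ (inj₁ (inj₁ (other-colours c x))) ◅ ε
      bicoloured⊆ {x} (zero , inj₁ refl , refl) = rematched⁺ (by-cases (endpoint? x)) ◅ ε
        where
        Edge∈ : Fin n → Fin n → Set
        Edge∈ u w = (u , w) ∈ rewiredEdges ρ
        by-cases : Dec (Endpoint x) → RematchedStep x (ι g′ zero x)
        by-cases (yes (k , inj₁ refl)) =
          inj₂ (inj₁ (subst (Edge∈ (black k)) (sym (at-black k)) (rewiredEdge⁺ ρ k)))
        by-cases (yes (k , inj₂ refl)) =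
          inj₂ (inj₂ (subst₂ Edge∈ (sym (at-white k)) (cong white (inverseʳ ρ)) (rewiredEdge⁺ ρ (ρ ⟨$⟩ˡ k))))
        by-cases (no x∉) = inj₁ (inj₂ (trans (elsewhere x∉) (sym (αX-outside x∉))))

      bicoloured⊇ : Rematched ⇒ Star Bicoloured
      bicoloured⊇ r with rematched⁻ r
      ... | inj₁ (inj₁ refl) = (suc c , inj₂ refl , sym (other-colours c _)) ◅ ε
      ... | inj₁ (inj₂ refl) = by-cases (endpoint? _)
        where
        by-cases : ∀ {x} → Dec (Endpoint x) → Star Bicoloured x (αX x)
        by-cases {x} (yes x∈) = subst (Star Bicoloured x) (sym (αX-inside x∈)) ε
        by-cases {x} (no x∉) = (zero , inj₁ refl , trans (αX-outside x∉) (sym (elsewhere x∉))) ◅ ε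
      ... | inj₂ (inj₁ xy∈) with rewiredEdge⁻ ρ xy∈
      ...   | k , refl , refl = (zero , inj₁ refl , sym (at-black k)) ◅ ε
      bicoloured⊇ r | inj₂ (inj₂ yx∈) with rewiredEdge⁻ ρ yx∈
      ...   | k , refl , refl =
        (zero , inj₁ refl , sym (trans (at-white (ρ ⟨$⟩ʳ k)) (cong black (inverseˡ ρ)))) ◅ ε

      numComponents-rewiring : ∃[ k ] NumComponents Bicoloured k × k + mergesAfter π ρ ≡ κ
      numComponents-rewiring =
        let k , count , k+m≡κ =
              numComponents-addEdges (_≟_ {4}) point cutUnion-count labels (rewiredMatching ρ)
        in k , numComponents-cong bicoloured⊇ bicoloured⊆ count , k+m≡κ

  module Swap (J : Fin 4) =
    Rewired (transpose zero J) {proj₁ (avoid-0-and J)}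
            (transpose-fixes (proj₁ (proj₂ (avoid-0-and J))) (proj₂ (proj₂ (avoid-0-and J))))

  swapPair : ∃₂ λ J₁ J₂ → ∀ c → SwapCounts (Colour.π c) J₁ J₂
  swapPair =
    let J₁ , J₂ , swapCounts = swaps (side ∘ black)
    in J₁ , J₂ , λ c → swapCounts (Colour.π c) (Colour.π-injective c) (Colour.alternating c)

  componentsAfterSwap : Fin 4 → Fin d → ℕ
  componentsAfterSwap J c = proj₁ (Colour.numComponents-rewiring c (Swap.isRewiring J))

  C0-swapped : ∀ J → C0 (Swap.rewired J) (sumFin (componentsAfterSwap J))
  C0-swapped J =
    componentsAfterSwap J ,
    (λ c → proj₁ (proj₂ (Colour.numComponents-rewiring c (Swap.isRewiring J)))) ,
    refl

  swapComponents : ∀ {c k J₁ J₂} → NumComponents (AdjCol (gr G) (Col0or (suc c))) k →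
                   SwapCounts (Colour.π c) J₁ J₂ →
                   SwapComponents k (componentsAfterSwap J₁ c) (componentsAfterSwap J₂ c)
  swapComponents {c} {k} {J₁} {J₂} count swapCounts = record
    { balance₁ = balance (Swap.isRewiring J₁)
    ; balance₂ = balance (Swap.isRewiring J₂)
    ; inequalities = swapCounts
    }
    where
    open Colour c using (π; κ; numComponents-rewiring)
    k+m≡κ : k + mergesAfter π id ≡ κ
    k+m≡κ =
      let k′ , count′ , k′+m≡κ = numComponents-rewiring G-isRewiring
      in trans (cong (_+ mergesAfter π id) (numComponents-unique count count′)) k′+m≡κ
    balance : ∀ {ρ g′} (rewiring : IsRewiring ρ g′) →
              k + mergesAfter π id ≡ proj₁ (numComponents-rewiring rewiring) + mergesAfter π ρ
    balance rewiring = trans k+m≡κ (sym (proj₂ (proj₂ (numComponents-rewiring rewiring))))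

mainTheorem18 : (d : ℕ) → Odd d → (N : ℕ) → (B : Bubble d) → (Bs : Fin N → Bubble d) →
    (ns : Fin N → ℕ) → (G : CGraph d) → InMaxSet B Bs ns G →
      ¬ (Σ (Fin 4 → Fin (nV G)) λ vs → IsBond {d} {4} G (λ i → (zero , vs i)))
mainTheorem18 _ odd _ _ _ _ G (inG , _ , (ks , counts , k≡Σks) , maximal) (vs , bond) =
  let J₁ , J₂ , swapCounts = swapPair
  in no-balanced-swaps odd (λ c → swapComponents (counts c) (swapCounts c)) (bounded J₁) (bounded J₂)
  where
  open FourBond G vs bond
  bounded : ∀ J → sumFin (componentsAfterSwap J) ≤ sumFin ks
  bounded J = subst (sumFin (componentsAfterSwap J) ≤_) k≡Σks
                    (maximal (Swap.rewired J) _ (Swap.rewired-inSet J inG) (C0-swapped J))
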